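{- (i) $\mathsf{I(=)} \nvdash \forall x\,(Sx \ne x)$ and $\mathsf{I(=)} \nvdash \forall x\forall y\forall z\,(x + z = x + y \rightarrow z = y)$. (ii) $\mathsf{I(=)} \nvdash \mathsf{I(\ne)}$.
   Context: The language is $\mathcal L_{ar} = (0, S, +, \cdot, \leqslant)$. Robinson arithmetic $\mathsf Q$ consists of the (universal closures of the) axioms: $Sx \ne 0$; $Sx = Sy \rightarrow x = y$; $x \ne 0 \rightarrow \exists y (x = Sy)$; $x + 0 = x$; $x + Sy = S(x+y)$; $x \cdot 0 = 0$; $x \cdot Sy = x\cdot y + x$; $x \leqslant y \leftrightarrow \exists r (r + x = y)$. The induction axiom for a formula $\varphi(x,\vec y)$ is the universal closure of $\varphi(0,\vec y) \wedge \forall x(\varphi(x,\vec y)\rightarrow \varphi(Sx,\vec y)) \rightarrow \forall x\, \varphi(x,\vec y)$. $\mathsf I(=)$ is $\mathsf Q$ plus induction for all formulas $t = s$, and $\mathsf I(\ne)$ is $\mathsf Q$ plus induction for all formulas $t \ne s$, with $t,s$ ranging over $\mathcal L_{ar}$-terms. -}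

module Defs where

open import Data.Nat using (ℕ; zero; suc; _<_)
open import Data.Product using (Σ; _×_; _,_)
open import Data.Sum using (_⊎_)
open import Relation.Binary.PropositionalEquality using (_≡_)

-- Syntax of first-order logic over L_ar = (0, S, +, ·, ≤),
-- de Bruijn variables (var 0 = innermost bound / first free variable).

infixl 7 _·'_
infixl 6 _+'_
infix  4 _≐_ _≤'_
infixr 3 _⇒_

data Term : Set where
  var   : ℕ → Term
  zero' : Term
  S'    : Term → Term
  _+'_  : Term → Term → Term
  _·'_  : Term → Term → Term

data Formula : Set where
  ⊥'   : Formula
  _≐_  : Term → Term → Formula
  _≤'_ : Term → Term → Formula
  _⇒_  : Formula → Formula → Formula
  ∀'   : Formula → Formula

¬' : Formula → Formula
¬' φ = φ ⇒ ⊥'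

_∧'_ : Formula → Formula → Formula
φ ∧' ψ = ¬' (φ ⇒ ¬' ψ)

_⇔_ : Formula → Formula → Formula
φ ⇔ ψ = (φ ⇒ ψ) ∧' (ψ ⇒ φ)

∃' : Formula → Formula
∃' φ = ¬' (∀' (¬' φ))

infixr 4 _∧'_
infix 2 _⇔_

renameT : (ℕ → ℕ) → Term → Term
renameT ρ (var n)  = var (ρ n)
renameT ρ zero'    = zero'
renameT ρ (S' t)   = S' (renameT ρ t)
renameT ρ (t +' s) = renameT ρ t +' renameT ρ s
renameT ρ (t ·' s) = renameT ρ t ·' renameT ρ s

substT : (ℕ → Term) → Term → Term
substT σ (var n)  = σ n
substT σ zero'    = zero'
substT σ (S' t)   = S' (substT σ t)
substT σ (t +' s) = substT σ t +' substT σ s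
substT σ (t ·' s) = substT σ t ·' substT σ s

liftS : (ℕ → Term) → ℕ → Term
liftS σ zero    = var zero
liftS σ (suc n) = renameT suc (σ n)

substF : (ℕ → Term) → Formula → Formula
substF σ ⊥'       = ⊥'
substF σ (t ≐ s)  = substT σ t ≐ substT σ s
substF σ (t ≤' s) = substT σ t ≤' substT σ s
substF σ (φ ⇒ ψ)  = substF σ φ ⇒ substF σ ψ
substF σ (∀' φ)   = ∀' (substF (liftS σ) φ)

shiftF : Formula → Formula
shiftF = substF (λ n → var (suc n))

sub₀ : Term → ℕ → Term
sub₀ t zero    = t
sub₀ t (suc n) = var n

_[_] : Formula → Term → Formula
φ [ t ] = substF (sub₀ t) φ

-- Free variables bounded by n (so that alls n φ is a sentence)

TBound : ℕ → Term → Set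
TBound n (var m)  = m < n
TBound n zero'    = Data.Unit.⊤ where import Data.Unit
TBound n (S' t)   = TBound n t
TBound n (t +' s) = TBound n t × TBound n s
TBound n (t ·' s) = TBound n t × TBound n s

FBound : ℕ → Formula → Set
FBound n ⊥'       = Data.Unit.⊤ where import Data.Unit
FBound n (t ≐ s)  = TBound n t × TBound n s
FBound n (t ≤' s) = TBound n t × TBound n s
FBound n (φ ⇒ ψ)  = FBound n φ × FBound n ψ
FBound n (∀' φ)   = FBound (suc n) φ

alls : ℕ → Formula → Formula
alls zero    φ = φ
alls (suc n) φ = ∀' (alls n φ)

Theory : Set₁
Theory = Formula → Set

data _⊢_ (T : Theory) : Formula → Set where
  hyp    : ∀ {φ} → T φ → T ⊢ φ
  ax-K   : ∀ {φ ψ} → T ⊢ (φ ⇒ ψ ⇒ φ)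
  ax-S   : ∀ {φ ψ χ} → T ⊢ ((φ ⇒ ψ ⇒ χ) ⇒ (φ ⇒ ψ) ⇒ φ ⇒ χ)
  ax-DN  : ∀ {φ} → T ⊢ (¬' (¬' φ) ⇒ φ)
  mp     : ∀ {φ ψ} → T ⊢ (φ ⇒ ψ) → T ⊢ φ → T ⊢ ψ
  ax-∀E  : ∀ {φ} (t : Term) → T ⊢ (∀' φ ⇒ φ [ t ])
  ax-∀D  : ∀ {φ ψ} → T ⊢ (∀' (shiftF ψ ⇒ φ) ⇒ ψ ⇒ ∀' φ)
  gen    : ∀ {φ} → T ⊢ φ → T ⊢ ∀' φ
  ax-ref : ∀ (t : Term) → T ⊢ (t ≐ t)
  ax-Lb  : ∀ {φ} (t s : Term) → T ⊢ (t ≐ s ⇒ φ [ t ] ⇒ φ [ s ])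

infix 1 _⊢_

v0 v1 v2 : Term
v0 = var 0
v1 = var 1
v2 = var 2

data QAx : Theory where
  q1 : QAx (∀' (¬' (S' v0 ≐ zero')))
  q2 : QAx (∀' (∀' (S' v1 ≐ S' v0 ⇒ v1 ≐ v0)))
  q3 : QAx (∀' (¬' (v0 ≐ zero') ⇒ ∃' (v1 ≐ S' v0)))
  q4 : QAx (∀' (v0 +' zero' ≐ v0))
  q5 : QAx (∀' (∀' (v1 +' S' v0 ≐ S' (v1 +' v0))))
  q6 : QAx (∀' (v0 ·' zero' ≐ zero'))
  q7 : QAx (∀' (∀' (v1 ·' S' v0 ≐ v1 ·' v0 +' v1)))
  q8 : QAx (∀' (∀' (v1 ≤' v0 ⇔ ∃' (v0 +' v2 ≐ v1))))

-- Induction axiom for φ(x, ȳ) with x = var 0 and parameters ȳ = var 1, var 2, …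
-- φ(0,ȳ) ∧ ∀x(φ(x,ȳ) → φ(Sx,ȳ)) → ∀x φ(x,ȳ)   (before universal closure)
zeroSub : ℕ → Term
zeroSub zero    = zero'
zeroSub (suc n) = var n

succSub : ℕ → Term
succSub zero    = S' (var zero)
succSub (suc n) = var (suc n)

Ind : Formula → Formula
Ind φ = (substF zeroSub φ ∧' ∀' (φ ⇒ substF succSub φ)) ⇒ ∀' φ

data IEq : Theory where
  iq   : ∀ {φ} → QAx φ → IEq φ
  iind : ∀ (n : ℕ) (t s : Term) → FBound n (Ind (t ≐ s)) → IEq (alls n (Ind (t ≐ s)))

data INeq : Theory where
  iq   : ∀ {φ} → QAx φ → INeq φ
  iind : ∀ (n : ℕ) (t s : Term) → FBound n (Ind (¬' (t ≐ s))) → INeq (alls n (Ind (¬' (t ≐ s))))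

_⊢Th_ : Theory → Theory → Set
T ⊢Th U = ∀ {φ} → U φ → T ⊢ φ

{-# OPTIONS --safe #-}
-- All three unprovabilities are witnessed by one model, ℕ ∪ {∞} with ∞ absorbing
-- (except that 0 · ∞ = ∞ · 0 = 0).  There S∞ = ∞ and ∞ + 1 = ∞ + 0, and induction
-- for Sx ≠ x fails at ∞.  Yet it is a model of I(=): as a function of one variable,
-- every term is either constant or unbounded (at least n at n, and ∞ at ∞), so an
-- equation between terms that holds at every standard number also holds at ∞.
module Submission where

open import Defs hiding (_⇔_)
open import Data.Empty using (⊥; ⊥-elim)
open import Data.Nat using (ℕ; zero; suc; _+_; _*_; _≤_; z≤n)
open import Data.Nat.Properties
  using (+-suc; +-identityʳ; +-comm; *-suc; *-zeroʳ; *-comm; m≤m+n; m≤m*n; ≤-trans; ≤-refl; n≤1+n; 1+n≰n; 0<1+n; suc-injective; _≟_)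
open import Data.Product using (_×_; _,_; proj₁; proj₂; ∃-syntax)
open import Data.Unit using (⊤; tt)
open import Function using (_∘_; id)
open import Function.Bundles using (_⇔_; mk⇔; Equivalence)
open import Relation.Binary.Definitions using (DecidableEquality)
open import Relation.Binary.PropositionalEquality using (_≡_; _≢_; refl; sym; trans; cong; cong₂; subst; module ≡-Reasoning)
open import Relation.Nullary using (¬_; Stable; yes; no; negated-stable)
open import Relation.Nullary.Decidable using (decidable-stable; map′)

open Equivalence using (to; from)

data ℕ∞ : Set where
  fin : ℕ → ℕ∞
  ∞   : ℕ∞

infixl 7 _*∞_
infixl 6 _+∞_

suc∞ : ℕ∞ → ℕ∞
suc∞ (fin n) = fin (suc n)
suc∞ ∞       = ∞

_+∞_ : ℕ∞ → ℕ∞ → ℕ∞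
fin m +∞ fin n = fin (m + n)
fin _ +∞ ∞     = ∞
∞     +∞ _     = ∞

_*∞_ : ℕ∞ → ℕ∞ → ℕ∞
fin m       *∞ fin n       = fin (m * n)
fin zero    *∞ ∞           = fin 0
fin (suc _) *∞ ∞           = ∞
∞           *∞ fin zero    = fin 0
∞           *∞ fin (suc _) = ∞
∞           *∞ ∞           = ∞

private variable
  m n : ℕ
  x y : ℕ∞
  f g : ℕ∞ → ℕ∞

fin-injective : fin m ≡ fin n → m ≡ n
fin-injective refl = refl

suc∞-injective : suc∞ x ≡ suc∞ y → x ≡ y
suc∞-injective {fin m} {fin n} eq = cong fin (suc-injective (fin-injective eq))
suc∞-injective {∞}     {∞}     _  = refl

_≟∞_ : DecidableEquality ℕ∞
fin m ≟∞ fin n = map′ (cong fin) fin-injective (m ≟ n)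
fin _ ≟∞ ∞     = no λ ()
∞     ≟∞ fin _ = no λ ()
∞     ≟∞ ∞     = yes refl

+∞-identityʳ : ∀ x → x +∞ fin 0 ≡ x
+∞-identityʳ (fin m) = cong fin (+-identityʳ m)
+∞-identityʳ ∞       = refl

+∞-suc : ∀ x y → x +∞ suc∞ y ≡ suc∞ (x +∞ y)
+∞-suc (fin m) (fin n) = cong fin (+-suc m n)
+∞-suc (fin _) ∞       = refl
+∞-suc ∞       _       = refl

+∞-comm : ∀ x y → x +∞ y ≡ y +∞ x
+∞-comm (fin m) (fin n) = cong fin (+-comm m n)
+∞-comm (fin _) ∞       = refl
+∞-comm ∞       (fin _) = refl
+∞-comm ∞       ∞       = refl

+∞-absorbingʳ : ∀ x → x +∞ ∞ ≡ ∞
+∞-absorbingʳ (fin _) = refl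
+∞-absorbingʳ ∞       = refl

*∞-zeroʳ : ∀ x → x *∞ fin 0 ≡ fin 0
*∞-zeroʳ (fin m) = cong fin (*-zeroʳ m)
*∞-zeroʳ ∞       = refl

*∞-comm : ∀ x y → x *∞ y ≡ y *∞ x
*∞-comm (fin m)       (fin n)       = cong fin (*-comm m n)
*∞-comm (fin zero)    ∞             = refl
*∞-comm (fin (suc _)) ∞             = refl
*∞-comm ∞             (fin zero)    = refl
*∞-comm ∞             (fin (suc _)) = refl
*∞-comm ∞             ∞             = refl

*∞-suc : ∀ x y → x *∞ suc∞ y ≡ x *∞ y +∞ x
*∞-suc (fin m)       (fin n) = cong fin (trans (*-suc m n) (+-comm m (m * n)))
*∞-suc (fin zero)    ∞       = refl
*∞-suc (fin (suc _)) ∞       = refl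
*∞-suc ∞             (fin n) = sym (+∞-absorbingʳ (∞ *∞ fin n))
*∞-suc ∞             ∞       = refl

∞-*∞-nonzero : y ≢ fin 0 → ∞ *∞ y ≡ ∞
∞-*∞-nonzero {fin zero}    y≢0 = ⊥-elim (y≢0 refl)
∞-*∞-nonzero {fin (suc _)} _   = refl
∞-*∞-nonzero {∞}           _   = refl

infix 4 _≤ᶠ_

_≤ᶠ_ : ℕ → ℕ∞ → Set
n ≤ᶠ fin m = n ≤ m
n ≤ᶠ ∞     = ⊤

z≤ᶠ : ∀ x → 0 ≤ᶠ x
z≤ᶠ (fin _) = z≤n
z≤ᶠ ∞       = tt

1+n≤ᶠ⇒≢0 : suc n ≤ᶠ x → x ≢ fin 0
1+n≤ᶠ⇒≢0 () refl

≤ᶠ-suc∞ : ∀ x → n ≤ᶠ x → n ≤ᶠ suc∞ x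
≤ᶠ-suc∞ {n} (fin m) n≤m = ≤-trans n≤m (n≤1+n m)
≤ᶠ-suc∞     ∞       _   = tt

≤ᶠ-+∞ʳ : ∀ x y → n ≤ᶠ x → n ≤ᶠ x +∞ y
≤ᶠ-+∞ʳ (fin m) (fin k) n≤m = ≤-trans n≤m (m≤m+n m k)
≤ᶠ-+∞ʳ (fin _) ∞       _   = tt
≤ᶠ-+∞ʳ ∞       _       _   = tt

≤ᶠ-*∞ʳ : ∀ x y → n ≤ᶠ x → y ≢ fin 0 → n ≤ᶠ x *∞ y
≤ᶠ-*∞ʳ (fin m)       (fin zero)    _   y≢0 = ⊥-elim (y≢0 refl)
≤ᶠ-*∞ʳ (fin m)       (fin (suc k)) n≤m _   = ≤-trans n≤m (m≤m*n m (suc k))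
≤ᶠ-*∞ʳ (fin zero)    ∞             n≤0 _   = n≤0
≤ᶠ-*∞ʳ (fin (suc _)) ∞             _   _   = tt
≤ᶠ-*∞ʳ ∞             (fin zero)    _   y≢0 = ⊥-elim (y≢0 refl)
≤ᶠ-*∞ʳ ∞             (fin (suc _)) _   _   = tt
≤ᶠ-*∞ʳ ∞             ∞             _   _   = tt

data ConstantOrUnbounded (f : ℕ∞ → ℕ∞) : Set where
  constant  : ∀ c → (∀ a → f a ≡ c) → ConstantOrUnbounded f
  unbounded : f ∞ ≡ ∞ → (∀ n → n ≤ᶠ f (fin n)) → ConstantOrUnbounded f

cou-resp : (∀ a → f a ≡ g a) → ConstantOrUnbounded f → ConstantOrUnbounded g
cou-resp f≗g (constant c fc) = constant c (λ a → trans (sym (f≗g a)) (fc a))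
cou-resp f≗g (unbounded f∞ fn) =
  unbounded (trans (sym (f≗g ∞)) f∞) (λ n → subst (n ≤ᶠ_) (f≗g (fin n)) (fn n))

cou-suc∞ : ConstantOrUnbounded f → ConstantOrUnbounded (suc∞ ∘ f)
cou-suc∞ (constant c fc)   = constant (suc∞ c) (cong suc∞ ∘ fc)
cou-suc∞ (unbounded f∞ fn) = unbounded (cong suc∞ f∞) (λ n → ≤ᶠ-suc∞ _ (fn n))

unbounded-+∞ : f ∞ ≡ ∞ → (∀ n → n ≤ᶠ f (fin n)) → ConstantOrUnbounded (λ a → f a +∞ g a)
unbounded-+∞ {f} {g} f∞ fn = unbounded (cong (_+∞ g ∞) f∞) (λ n → ≤ᶠ-+∞ʳ (f (fin n)) (g (fin n)) (fn n))

cou-+∞ : ConstantOrUnbounded f → ConstantOrUnbounded g → ConstantOrUnbounded (λ a → f a +∞ g a)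
cou-+∞         (constant c fc)   (constant d gd)   = constant (c +∞ d) (λ a → cong₂ _+∞_ (fc a) (gd a))
cou-+∞         (unbounded f∞ fn) _                 = unbounded-+∞ f∞ fn
cou-+∞ {f} {g} (constant _ _)    (unbounded g∞ gn) = cou-resp (λ a → +∞-comm (g a) (f a)) (unbounded-+∞ g∞ gn)

unbounded-*∞ : f ∞ ≡ ∞ → (∀ n → n ≤ᶠ f (fin n)) → ConstantOrUnbounded g →
               ConstantOrUnbounded (λ a → f a *∞ g a)
unbounded-*∞ {f} {g} f∞ fn (constant d gd) with d ≟∞ fin 0
... | yes refl = constant (fin 0) (λ a → trans (cong (f a *∞_) (gd a)) (*∞-zeroʳ (f a)))
... | no d≢0   = unbounded (trans (cong₂ _*∞_ f∞ (gd ∞)) (∞-*∞-nonzero d≢0)) at-fin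
  where
  at-fin : ∀ n → n ≤ᶠ f (fin n) *∞ g (fin n)
  at-fin n = subst (λ y → n ≤ᶠ f (fin n) *∞ y) (sym (gd (fin n))) (≤ᶠ-*∞ʳ (f (fin n)) d (fn n) d≢0)
unbounded-*∞ {f} {g} f∞ fn (unbounded g∞ gn) = unbounded (cong₂ _*∞_ f∞ g∞) at-fin
  where
  at-fin : ∀ n → n ≤ᶠ f (fin n) *∞ g (fin n)
  at-fin zero    = z≤ᶠ _
  at-fin (suc n) = ≤ᶠ-*∞ʳ (f (fin (suc n))) (g (fin (suc n))) (fn (suc n)) (1+n≤ᶠ⇒≢0 (gn (suc n)))

cou-*∞ : ConstantOrUnbounded f → ConstantOrUnbounded g → ConstantOrUnbounded (λ a → f a *∞ g a)
cou-*∞         (constant c fc)   (constant d gd)     = constant (c *∞ d) (λ a → cong₂ _*∞_ (fc a) (gd a))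
cou-*∞         (unbounded f∞ fn) cg                  = unbounded-*∞ f∞ fn cg
cou-*∞ {f} {g} cf@(constant _ _) (unbounded g∞ gn)   = cou-resp (λ a → *∞-comm (g a) (f a)) (unbounded-*∞ g∞ gn cf)

constant-agreeing-with-unbounded : ∀ c → (∀ a → f a ≡ c) → g ∞ ≡ ∞ → (∀ n → n ≤ᶠ g (fin n)) →
                                   (∀ n → f (fin n) ≡ g (fin n)) → f ∞ ≡ g ∞
constant-agreeing-with-unbounded ∞ fc g∞ _ _ = trans (fc ∞) (sym g∞)
constant-agreeing-with-unbounded {f} {g} (fin m) fc _ gn f≗g =
  ⊥-elim (1+n≰n (subst (suc m ≤ᶠ_) (trans (sym (f≗g (suc m))) (fc (fin (suc m)))) (gn (suc m))))

cou-agree-at-∞ : ConstantOrUnbounded f → ConstantOrUnbounded g → (∀ n → f (fin n) ≡ g (fin n)) → f ∞ ≡ g ∞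
cou-agree-at-∞ {f} {g} (constant c fc) (constant d gd) f≗g = begin
  f ∞       ≡⟨ fc ∞ ⟩
  c         ≡⟨ fc (fin 0) ⟨
  f (fin 0) ≡⟨ f≗g 0 ⟩
  g (fin 0) ≡⟨ gd (fin 0) ⟩
  d         ≡⟨ gd ∞ ⟨
  g ∞       ∎
  where open ≡-Reasoning
cou-agree-at-∞ {f} {g} (constant c fc)   (unbounded g∞ gn) f≗g =
  constant-agreeing-with-unbounded {f} {g} c fc g∞ gn f≗g
cou-agree-at-∞ {f} {g} (unbounded f∞ fn) (constant d gd)   f≗g =
  sym (constant-agreeing-with-unbounded {g} {f} d gd f∞ fn (sym ∘ f≗g))
cou-agree-at-∞         (unbounded f∞ _)  (unbounded g∞ _)  _   = trans f∞ (sym g∞)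

Env : Set
Env = ℕ → ℕ∞

infixr 5 _∷ₑ_

_∷ₑ_ : ℕ∞ → Env → Env
(a ∷ₑ ρ) zero    = a
(a ∷ₑ ρ) (suc n) = ρ n

⟦_⟧ : Term → Env → ℕ∞
⟦ var n  ⟧ ρ = ρ n
⟦ zero'  ⟧ ρ = fin 0
⟦ S' t   ⟧ ρ = suc∞ (⟦ t ⟧ ρ)
⟦ t +' s ⟧ ρ = ⟦ t ⟧ ρ +∞ ⟦ s ⟧ ρ
⟦ t ·' s ⟧ ρ = ⟦ t ⟧ ρ *∞ ⟦ s ⟧ ρ

infix 2 _⊨_

-- ≤ is read with a double negation, matching the encoding ∃' = ¬'∀'¬' in axiom q8.
_⊨_ : Env → Formula → Set
ρ ⊨ ⊥'     = ⊥
ρ ⊨ t ≐ s  = ⟦ t ⟧ ρ ≡ ⟦ s ⟧ ρ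
ρ ⊨ t ≤' s = ¬ ¬ (∃[ r ] r +∞ ⟦ t ⟧ ρ ≡ ⟦ s ⟧ ρ)
ρ ⊨ φ ⇒ ψ  = ρ ⊨ φ → ρ ⊨ ψ
ρ ⊨ ∀' φ   = ∀ a → a ∷ₑ ρ ⊨ φ

Valid : Formula → Set
Valid φ = ∀ ρ → ρ ⊨ φ

⊨-stable : ∀ φ ρ → Stable (ρ ⊨ φ)
⊨-stable ⊥'       ρ ¬¬⊥   = ¬¬⊥ id
⊨-stable (t ≐ s)  ρ       = decidable-stable (⟦ t ⟧ ρ ≟∞ ⟦ s ⟧ ρ)
⊨-stable (t ≤' s) ρ       = negated-stable
⊨-stable (φ ⇒ ψ)  ρ ¬¬h p = ⊨-stable ψ ρ (λ ¬q → ¬¬h (λ h → ¬q (h p)))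
⊨-stable (∀' φ)   ρ ¬¬h a = ⊨-stable φ (a ∷ₑ ρ) (λ ¬p → ¬¬h (λ h → ¬p (h a)))

⊨-∧ : ∀ φ ψ {ρ} → ρ ⊨ φ ∧' ψ → (ρ ⊨ φ) × (ρ ⊨ ψ)
⊨-∧ φ ψ {ρ} p∧q = ⊨-stable φ ρ (λ ¬p → p∧q (λ p _ → ¬p p)) , ⊨-stable ψ ρ (λ ¬q → p∧q (λ _ q → ¬q q))

⟦⟧-renameT : ∀ (r : ℕ → ℕ) t ρ → ⟦ renameT r t ⟧ ρ ≡ ⟦ t ⟧ (ρ ∘ r)
⟦⟧-renameT r (var n)  ρ = refl
⟦⟧-renameT r zero'    ρ = refl
⟦⟧-renameT r (S' t)   ρ = cong suc∞ (⟦⟧-renameT r t ρ)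
⟦⟧-renameT r (t +' s) ρ = cong₂ _+∞_ (⟦⟧-renameT r t ρ) (⟦⟧-renameT r s ρ)
⟦⟧-renameT r (t ·' s) ρ = cong₂ _*∞_ (⟦⟧-renameT r t ρ) (⟦⟧-renameT r s ρ)

⟦⟧-substT : ∀ σ t {ρ ρ′} → (∀ n → ⟦ σ n ⟧ ρ ≡ ρ′ n) → ⟦ substT σ t ⟧ ρ ≡ ⟦ t ⟧ ρ′
⟦⟧-substT σ (var n)  σ≗ρ′ = σ≗ρ′ n
⟦⟧-substT σ zero'    σ≗ρ′ = refl
⟦⟧-substT σ (S' t)   σ≗ρ′ = cong suc∞ (⟦⟧-substT σ t σ≗ρ′)
⟦⟧-substT σ (t +' s) σ≗ρ′ = cong₂ _+∞_ (⟦⟧-substT σ t σ≗ρ′) (⟦⟧-substT σ s σ≗ρ′)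
⟦⟧-substT σ (t ·' s) σ≗ρ′ = cong₂ _*∞_ (⟦⟧-substT σ t σ≗ρ′) (⟦⟧-substT σ s σ≗ρ′)

⟦⟧-liftS : ∀ σ {ρ ρ′} a → (∀ n → ⟦ σ n ⟧ ρ ≡ ρ′ n) → ∀ n → ⟦ liftS σ n ⟧ (a ∷ₑ ρ) ≡ (a ∷ₑ ρ′) n
⟦⟧-liftS σ a σ≗ρ′ zero    = refl
⟦⟧-liftS σ a σ≗ρ′ (suc n) = trans (⟦⟧-renameT suc (σ n) (a ∷ₑ _)) (σ≗ρ′ n)

⊨-substF : ∀ φ σ {ρ ρ′} → (∀ n → ⟦ σ n ⟧ ρ ≡ ρ′ n) → (ρ ⊨ substF σ φ) ⇔ (ρ′ ⊨ φ)
⊨-substF ⊥'       σ σ≗ρ′ = mk⇔ id id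
⊨-substF (t ≐ s)  σ σ≗ρ′ rewrite ⟦⟧-substT σ t σ≗ρ′ | ⟦⟧-substT σ s σ≗ρ′ = mk⇔ id id
⊨-substF (t ≤' s) σ σ≗ρ′ rewrite ⟦⟧-substT σ t σ≗ρ′ | ⟦⟧-substT σ s σ≗ρ′ = mk⇔ id id
⊨-substF (φ ⇒ ψ)  σ σ≗ρ′ =
  mk⇔ (λ h → to ψ⇔ ∘ h ∘ from φ⇔) (λ h → from ψ⇔ ∘ h ∘ to φ⇔)
  where
  φ⇔ : (_ ⊨ substF σ φ) ⇔ (_ ⊨ φ)
  φ⇔ = ⊨-substF φ σ σ≗ρ′
  ψ⇔ : (_ ⊨ substF σ ψ) ⇔ (_ ⊨ ψ)
  ψ⇔ = ⊨-substF ψ σ σ≗ρ′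
⊨-substF (∀' φ)   σ σ≗ρ′ =
  mk⇔ (λ h a → to (φ⇔ a) (h a)) (λ h a → from (φ⇔ a) (h a))
  where
  φ⇔ : ∀ a → (a ∷ₑ _ ⊨ substF (liftS σ) φ) ⇔ (a ∷ₑ _ ⊨ φ)
  φ⇔ a = ⊨-substF φ (liftS σ) (⟦⟧-liftS σ a σ≗ρ′)

⊨-[] : ∀ φ t {ρ} → (ρ ⊨ φ [ t ]) ⇔ (⟦ t ⟧ ρ ∷ₑ ρ ⊨ φ)
⊨-[] φ t = ⊨-substF φ (sub₀ t) λ { zero → refl ; (suc n) → refl }

⊨-shiftF : ∀ φ {ρ} a → (a ∷ₑ ρ ⊨ shiftF φ) ⇔ (ρ ⊨ φ)
⊨-shiftF φ a = ⊨-substF φ (var ∘ suc) (λ n → refl)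

cou-⟦⟧ : ∀ t ρ → ConstantOrUnbounded (λ a → ⟦ t ⟧ (a ∷ₑ ρ))
cou-⟦⟧ (var zero)    ρ = unbounded refl (λ n → ≤-refl)
cou-⟦⟧ (var (suc n)) ρ = constant (ρ n) (λ _ → refl)
cou-⟦⟧ zero'         ρ = constant (fin 0) (λ _ → refl)
cou-⟦⟧ (S' t)        ρ = cou-suc∞ (cou-⟦⟧ t ρ)
cou-⟦⟧ (t +' s)      ρ = cou-+∞ (cou-⟦⟧ t ρ) (cou-⟦⟧ s ρ)
cou-⟦⟧ (t ·' s)      ρ = cou-*∞ (cou-⟦⟧ t ρ) (cou-⟦⟧ s ρ)

≐-at-∞ : ∀ t s ρ → (∀ n → fin n ∷ₑ ρ ⊨ t ≐ s) → ∞ ∷ₑ ρ ⊨ t ≐ s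
≐-at-∞ t s ρ = cou-agree-at-∞ (cou-⟦⟧ t ρ) (cou-⟦⟧ s ρ)

Ind-valid : ∀ φ → (∀ ρ → (∀ n → fin n ∷ₑ ρ ⊨ φ) → ∞ ∷ₑ ρ ⊨ φ) → Valid (Ind φ)
Ind-valid φ φ-at-∞ ρ premise = everywhere
  where
  premises : (ρ ⊨ substF zeroSub φ) × (ρ ⊨ ∀' (φ ⇒ substF succSub φ))
  premises = ⊨-∧ (substF zeroSub φ) (∀' (φ ⇒ substF succSub φ)) premise
  base : fin 0 ∷ₑ ρ ⊨ φ
  base = to (⊨-substF φ zeroSub λ { zero → refl ; (suc n) → refl }) (proj₁ premises)
  step : ∀ a → a ∷ₑ ρ ⊨ φ → suc∞ a ∷ₑ ρ ⊨ φ
  step a p = to (⊨-substF φ succSub λ { zero → refl ; (suc n) → refl }) (proj₂ premises a p)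
  at-fin : ∀ n → fin n ∷ₑ ρ ⊨ φ
  at-fin zero    = base
  at-fin (suc n) = step (fin n) (at-fin n)
  everywhere : ∀ a → a ∷ₑ ρ ⊨ φ
  everywhere (fin n) = at-fin n
  everywhere ∞       = φ-at-∞ ρ at-fin

alls-valid : ∀ n {φ} → Valid φ → Valid (alls n φ)
alls-valid zero    ⊨φ = ⊨φ
alls-valid (suc n) ⊨φ ρ a = alls-valid n ⊨φ (a ∷ₑ ρ)

QAx-valid : ∀ {φ} → QAx φ → Valid φ
QAx-valid q1 ρ (fin _) ()
QAx-valid q1 ρ ∞       ()
QAx-valid q2 ρ x y     = suc∞-injective
QAx-valid q3 ρ (fin zero)    x≢0 _    = x≢0 refl
QAx-valid q3 ρ (fin (suc n)) _   ¬pred = ¬pred (fin n) refl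
QAx-valid q3 ρ ∞             _   ¬pred = ¬pred ∞ refl
QAx-valid q4 ρ x       = +∞-identityʳ x
QAx-valid q5 ρ x y     = +∞-suc x y
QAx-valid q6 ρ x       = *∞-zeroʳ x
QAx-valid q7 ρ x y     = *∞-suc x y
QAx-valid q8 ρ x y ¬iff =
  ¬iff (λ ¬¬∃ ∀¬ → ¬¬∃ (λ (r , eq) → ∀¬ r eq)) (λ ¬∀¬ ¬∃ → ¬∀¬ (λ r eq → ¬∃ (r , eq)))

sound : ∀ {T φ} → (∀ {ψ} → T ψ → Valid ψ) → T ⊢ φ → Valid φ
sound T-valid (hyp Tφ)         ρ = T-valid Tφ ρ
sound T-valid ax-K             ρ = λ p _ → p
sound T-valid ax-S             ρ = λ f g p → f p (g p)
sound T-valid (ax-DN {φ})      ρ = ⊨-stable φ ρ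
sound T-valid (mp ⊢φ⇒ψ ⊢φ)     ρ = sound T-valid ⊢φ⇒ψ ρ (sound T-valid ⊢φ ρ)
sound T-valid (ax-∀E {φ} t)    ρ ∀φ = from (⊨-[] φ t) (∀φ (⟦ t ⟧ ρ))
sound T-valid (ax-∀D {φ} {ψ})  ρ ∀ψ⇒φ q a = ∀ψ⇒φ a (from (⊨-shiftF ψ a) q)
sound T-valid (gen ⊢φ)         ρ a = sound T-valid ⊢φ (a ∷ₑ ρ)
sound T-valid (ax-ref t)       ρ = refl
sound T-valid (ax-Lb {φ} t s)  ρ t≡s p =
  from (⊨-[] φ s) (subst (λ a → a ∷ₑ ρ ⊨ φ) t≡s (to (⊨-[] φ t) p))

IEq-valid : ∀ {φ} → IEq φ → Valid φ
IEq-valid (iq q)         = QAx-valid q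
IEq-valid (iind n t s _) = alls-valid n (Ind-valid (t ≐ s) (≐-at-∞ t s))

S≢id : Formula
S≢id = ¬' (S' v0 ≐ v0)

Ind-S≢id-sentence : FBound 0 (Ind S≢id)
Ind-S≢id-sentence =
  ((((_ , _) , _) , (((0<1+n , 0<1+n) , _) , ((0<1+n , 0<1+n) , _)) , _) , _) , ((0<1+n , 0<1+n) , _)

Ind-S≢id-invalid : ¬ Valid (Ind S≢id)
Ind-S≢id-invalid valid = valid (λ _ → ∞) premise ∞ refl
  where
  premise : (λ _ → ∞) ⊨ substF zeroSub S≢id ∧' ∀' (S≢id ⇒ substF succSub S≢id)
  premise base⇒¬step = base⇒¬step (λ ()) (λ a ih eq → ih (suc∞-injective eq))

proposition3p1 : ( ¬ (IEq ⊢ ∀' (¬' (S' v0 ≐ v0)))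
    × ¬ (IEq ⊢ ∀' (∀' (∀' (v2 +' v0 ≐ v2 +' v1 ⇒ v0 ≐ v1)))) )
    × ¬ (IEq ⊢Th INeq)
proposition3p1 =
  ( (λ ⊢S≢id → sound IEq-valid ⊢S≢id ρ∞ ∞ refl)
  , (λ ⊢cancel → 0≢1 (sound IEq-valid ⊢cancel ρ∞ ∞ (fin 1) (fin 0) refl)) )
  , (λ ⊢INeq → Ind-S≢id-invalid (sound IEq-valid (⊢INeq (iind 0 (S' v0) v0 Ind-S≢id-sentence))))
  where
  ρ∞ : Env
  ρ∞ _ = ∞
  0≢1 : fin 0 ≢ fin 1
  0≢1 ()
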